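{- Let $G=G([n],E)$ be a simple graph. There is a bijection $\Phi$ from the set of $\mathbf{r}$-rooted spanning trees $T$ of $G_{\mathbf{r}}$ such that, with $p=p_T$, for every edge $(i,i_{\mathbf{r}})\in E(T)$ and every $j\in[n]$ with $p(i_{\mathbf{r}})<p(j)<p(i)$ we have $\{i,j\}\notin E$, onto the set of acyclic orientations of $G$. Moreover, if $\Phi(T)=O$ then the map $f:[n]\to[n]$, $f(m)=n+1-p_T(m)$, is a linear extension of $O$, and for every edge $(i,i_{\mathbf{r}})\in E(T)$ with $i,i_{\mathbf{r}}\in[n]$, $i_{\mathbf{r}}$ covers $i$ in $O$.
   Context: $G_{\mathbf{r}}$ is $G$ with an added vertex $\mathbf{r}$ adjacent to all vertices of $G$; an $\mathbf{r}$-rooted spanning tree has all edges directed towards $\mathbf{r}$, and $(i,i_{\mathbf{r}})$ denotes the unique edge out of $i\in[n]$. For such $T$, $p_T$ is the unique bijection $[n]\sqcup\{\mathbf{r}\}\to\{0,\dots,n\}$ such that $(u,v)\in E(T)\Rightarrow p_T(v)<p_T(u)$; for edges $(i,k),(j,k)$ of $T$ with $i<j$, $p_T(i)>p_T(j)$; and no two edges $(u,v),(u',v')$ of $T$ satisfy $p_T(v)<p_T(v')<p_T(u)<p_T(u')$ (non-crossing semicircle drawing). An acyclic orientation $O$ of $G$ orients every edge with no directed cycle and is viewed as the poset on $[n]$ it generates, $(u,v)$ meaning $u<_O v$; a linear extension is a bijection $f:[n]\to[n]$ with $u<_O v\Rightarrow f(u)<f(v)$. -}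

module Defs where

open import Data.Nat as ℕ using (ℕ; zero; suc; _∸_)
open import Data.Fin as F using (Fin; toℕ)
open import Data.Maybe using (Maybe; just; nothing)
open import Data.Bool using (Bool; true; false)
open import Data.Sum using (_⊎_)
open import Data.Product using (Σ; ∃; ∃-syntax; _×_; _,_; proj₁)
open import Relation.Nullary using (¬_)
open import Relation.Binary.PropositionalEquality using (_≡_; _≗_)
open import Relation.Binary.Construct.Closure.Transitive using (TransClosure)
open import Function.Definitions using (Bijective; Injective)

-- A simple graph on the vertex set [n], represented as Fin n
-- (vertex k of the paper is the element k-1 of Fin n; the order is the same).
record SimpleGraph (n : ℕ) : Set where
  field
    adj    : Fin n → Fin n → Bool
    sym    : ∀ i j → adj i j ≡ adj j i
    irrefl : ∀ i → adj i i ≡ false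
open SimpleGraph public

-- Vertices of G_r : just i for i ∈ [n], nothing for the root r.
V : ℕ → Set
V n = Maybe (Fin n)

climb : ∀ {n} → (Fin n → V n) → ℕ → V n → V n
climb par zero v = v
climb par (suc m) nothing = nothing
climb par (suc m) (just i) = climb par m (par i)

-- An r-rooted spanning tree of G_r: each i ∈ [n] has exactly one out-edge
-- (i , i_r) with i_r = par i (nothing = r); edges to r always exist in G_r,
-- edges between vertices of [n] must be edges of G; and there are no cycles
-- (every vertex reaches the root r following the out-edges).
record RootedTree {n} (G : SimpleGraph n) : Set where
  field
    par      : Fin n → V n
    par-edge : ∀ i k → par i ≡ just k → adj G i k ≡ true
    reaches  : ∀ i → ∃[ m ] climb par m (just i) ≡ nothing
open RootedTree public

_<F_ : ∀ {m} → Fin m → Fin m → Set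
a <F b = toℕ a ℕ.< toℕ b

IsPT : ∀ {n} {G : SimpleGraph n} → RootedTree G → (V n → Fin (suc n)) → Set
IsPT {n} T p =
  Bijective _≡_ _≡_ p
  × (∀ i → p (par T i) <F p (just i))
  × (∀ i j → par T i ≡ par T j → i <F j → p (just j) <F p (just i))
  × (∀ i i' → ¬ (p (par T i) <F p (par T i')
                 × p (par T i') <F p (just i)
                 × p (just i) <F p (just i')))

Condition : ∀ {n} {G : SimpleGraph n} → RootedTree G → (V n → Fin (suc n)) → Set
Condition {G = G} T p =
  ∀ i j → p (par T i) <F p (just j) → p (just j) <F p (just i) → adj G i j ≡ false

GoodTree : ∀ {n} → SimpleGraph n → Set
GoodTree G = Σ (RootedTree G) λ T → ∀ p → IsPT T p → Condition T p

-- An acyclic orientation: dir u v = true means the edge {u,v} is oriented (u,v).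
record AcyclicOrientation {n} (G : SimpleGraph n) : Set where
  field
    dir       : Fin n → Fin n → Bool
    dir-edge  : ∀ u v → dir u v ≡ true → adj G u v ≡ true
    orient    : ∀ u v → adj G u v ≡ true → (dir u v ≡ true × dir v u ≡ false)
                                        ⊎ (dir u v ≡ false × dir v u ≡ true)
    acyclic   : ∀ u → ¬ TransClosure (λ a b → dir a b ≡ true) u u
open AcyclicOrientation public

_<[_]_ : ∀ {n} {G : SimpleGraph n} → Fin n → AcyclicOrientation G → Fin n → Set
u <[ O ] v = TransClosure (λ a b → dir O a b ≡ true) u v

IsLinearExtension : ∀ {n} {G : SimpleGraph n} → AcyclicOrientation G → (Fin n → Fin n) → Set
IsLinearExtension O f = Bijective _≡_ _≡_ f × (∀ u v → u <[ O ] v → f u <F f v)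

Covers : ∀ {n} {G : SimpleGraph n} → AcyclicOrientation G → Fin n → Fin n → Set
Covers O b a = a <[ O ] b × ¬ (∃[ w ] (a <[ O ] w × w <[ O ] b))

-- Φ is a bijection GoodTree G → AcyclicOrientation G, where trees are identified
-- when they have the same edges and orientations when they orient edges equally.
IsBijection : ∀ {n} {G : SimpleGraph n} → (GoodTree G → AcyclicOrientation G) → Set
IsBijection {G = G} Φ =
  (∀ T T' → dir (Φ T) ≗₂ dir (Φ T') → par (proj₁ T) ≗ par (proj₁ T'))
  × (∀ (O : AcyclicOrientation G) → ∃[ T ] (dir (Φ T) ≗₂ dir O))
  where
    _≗₂_ : ∀ {n} → (Fin n → Fin n → Bool) → (Fin n → Fin n → Bool) → Set
    d ≗₂ d' = ∀ u v → d u v ≡ d' u v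

module Submission where

-- Everything rests on one greedy procedure.  Given an acyclic "up" relation
-- on [n], place the vertices one at a time at positions 1,2,…,n, each time
-- choosing, among the vertices whose up-neighbours are all placed, one whose
-- latest placed up-neighbour (its *anchor*) is as late as possible, ties
-- broken by the larger label.  Run on the parent relation of a tree this is
-- the depth-first order of p_T, which gives (1); the greedy choice yields the
-- sibling and non-crossing conditions.  A strong induction on labels shows
-- p_T is unique, and the same induction, fed with "the parent of a vertex is
-- its out-neighbour of largest label" (the non-adjacency condition), shows Φ
-- is injective.  Run on an acyclic orientation O, the procedure produces the
-- tree whose parents are the anchors, which is good and maps to O.

open import Defs hiding (sym)
open import Data.Nat as ℕ using (ℕ; zero; suc; _∸_; _+_; _*_; _≤_; _<_; z≤n; s≤s; _≤?_; _<?_)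
import Data.Nat.Properties as ℕₚ
open import Data.Nat.Induction using (<-rec)
open import Data.Fin as F using (Fin; toℕ; fromℕ<)
open import Data.Fin.Properties using (toℕ-injective; toℕ<n; toℕ-fromℕ<; any?; all?; pigeonhole)
open import Data.Maybe as Maybe using (Maybe; just; nothing; is-just)
open import Data.Maybe.Properties using (just-injective)
import Data.Maybe.Properties as Maybeₚ
open import Data.Bool as Bool using (Bool; true; false; if_then_else_)
import Data.Bool.Properties as Boolₚ
open import Data.Sum using (_⊎_; inj₁; inj₂)
open import Data.Product using (Σ; ∃; ∃-syntax; _×_; _,_; proj₁; proj₂)
open import Data.Empty using (⊥; ⊥-elim)
open import Relation.Nullary using (¬_; Dec; yes; no; does; contradiction)
open import Relation.Nullary.Decidable using (_×-dec_; _→-dec_; dec-true; dec-false)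
open import Relation.Binary using (tri<; tri≈; tri>)
open import Relation.Binary.PropositionalEquality using (_≡_; refl; sym; trans; cong; subst; subst₂; _≗_; _≢_)
open import Function using (_∘_)
open import Function.Definitions using (Bijective; Injective; Surjective)
open import Relation.Binary.Construct.Closure.Transitive using (TransClosure; [_]; _∷_; _∷ʳ_)

nothing≢just : ∀ {A : Set} {x : A} {B : Set} → nothing ≡ just x → B
nothing≢just ()

true≢false : ∀ {B : Set} → true ≡ false → B
true≢false ()

holds : ∀ {A : Set} (a? : Dec A) → does a? ≡ true → A
holds (yes a) _ = a

pred-injective : ∀ {a b} → 0 < a → 0 < b → ℕ.pred a ≡ ℕ.pred b → a ≡ b
pred-injective (s≤s _) (s≤s _) e = cong suc e

-- A pair (a, i) with i < n is encoded as a * n + i; the encoding is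
-- order-preserving for the lexicographic order.
lex-decode : ∀ n a b (i j : Fin n) → a * n + toℕ i ≤ b * n + toℕ j → i ≢ j →
             a < b ⊎ (a ≡ b × toℕ i < toℕ j)
lex-decode n a b i j le i≢j with ℕₚ.<-cmp a b
... | tri< a<b _ _ = inj₁ a<b
... | tri≈ _ refl _ = inj₂ (refl , ℕₚ.≤∧≢⇒< (ℕₚ.+-cancelˡ-≤ (a * n) (toℕ i) (toℕ j) le) (i≢j ∘ toℕ-injective))
... | tri> _ _ b<a = contradiction le (ℕₚ.<⇒≱ (begin-strict
    b * n + toℕ j   <⟨ ℕₚ.+-monoʳ-< (b * n) (toℕ<n j) ⟩
    b * n + n       ≡⟨ ℕₚ.+-comm (b * n) n ⟩
    suc b * n       ≤⟨ ℕₚ.*-monoˡ-≤ n b<a ⟩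
    a * n           ≤⟨ ℕₚ.m≤m+n (a * n) (toℕ i) ⟩
    a * n + toℕ i   ∎))
  where open ℕₚ.≤-Reasoning

-- Arg-max of a finite family of optional naturals: an index carrying the
-- largest defined value (ties go to the larger index), or nothing if no
-- value is defined.

maxArg : ∀ {n} → (Fin n → Maybe ℕ) → Maybe (Fin n × ℕ)
maxArg {zero} f = nothing
maxArg {suc n} f = larger (f F.zero) (maxArg (f ∘ F.suc))
  where
    larger : Maybe ℕ → Maybe (Fin n × ℕ) → Maybe (Fin (suc n) × ℕ)
    larger nothing nothing = nothing
    larger nothing (just (i , k)) = just (F.suc i , k)
    larger (just a) nothing = just (F.zero , a)
    larger (just a) (just (i , k)) with a ≤? k
    ... | yes _ = just (F.suc i , k)
    ... | no _ = just (F.zero , a)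

data MaxArg {n} (f : Fin n → Maybe ℕ) : Maybe (Fin n × ℕ) → Set where
  undefined : (∀ i → f i ≡ nothing) → MaxArg f nothing
  attained  : ∀ i k → f i ≡ just k → (∀ j k' → f j ≡ just k' → k' ≤ k) → MaxArg f (just (i , k))

maxArg-spec : ∀ {n} (f : Fin n → Maybe ℕ) → MaxArg f (maxArg f)
maxArg-spec {zero} f = undefined (λ ())
maxArg-spec {suc n} f with f F.zero in f0 | maxArg (f ∘ F.suc) | maxArg-spec (f ∘ F.suc)
... | nothing | .nothing | undefined h = undefined λ { F.zero → f0 ; (F.suc i) → h i }
... | nothing | .(just (i , k)) | attained i k fi max =
  attained (F.suc i) k fi λ { F.zero k' e → nothing≢just (trans (sym f0) e) ; (F.suc j) → max j }
... | just a | .nothing | undefined h =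
  attained F.zero a f0 λ { F.zero k' e → ℕₚ.≤-reflexive (just-injective (trans (sym e) f0))
                         ; (F.suc j) k' e → nothing≢just (trans (sym (h j)) e) }
... | just a | .(just (i , k)) | attained i k fi max with a ≤? k
...   | yes a≤k = attained (F.suc i) k fi
        λ { F.zero k' e → subst (_≤ k) (just-injective (trans (sym f0) e)) a≤k ; (F.suc j) → max j }
...   | no a≰k = attained F.zero a f0
        λ { F.zero k' e → ℕₚ.≤-reflexive (just-injective (trans (sym e) f0))
          ; (F.suc j) k' e → ℕₚ.≤-trans (max j k' e) (ℕₚ.<⇒≤ (ℕₚ.≰⇒> a≰k)) }

maxArg-just : ∀ {n} (f : Fin n → Maybe ℕ) {i k} → maxArg f ≡ just (i , k) →
              f i ≡ just k × (∀ j k' → f j ≡ just k' → k' ≤ k)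
maxArg-just f e with maxArg f | maxArg-spec f
maxArg-just f refl | _ | attained _ _ fi max = fi , max

maxArg-nothing : ∀ {n} (f : Fin n → Maybe ℕ) → maxArg f ≡ nothing → ∀ i → f i ≡ nothing
maxArg-nothing f e with maxArg f | maxArg-spec f
maxArg-nothing f refl | _ | undefined h = h

maxArg-cong : ∀ {n} (f g : Fin n → Maybe ℕ) → f ≗ g → maxArg f ≡ maxArg g
maxArg-cong {zero} f g h = refl
maxArg-cong {suc n} f g h rewrite h F.zero | maxArg-cong (f ∘ F.suc) (g ∘ F.suc) (h ∘ F.suc) = refl

Unblocked : ∀ {n} → (Fin n → Fin n → Bool) → Set
Unblocked {n} up = ∀ (placed : Fin n → Bool) x → placed x ≡ false →
  ∃ λ y → placed y ≡ false × (∀ v → up y v ≡ true → placed v ≡ true)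

-- Acyclic relations are unblocked: from an unplaced vertex keep stepping to
-- an unplaced up-neighbour; after n steps a vertex repeats, closing a cycle.
acyclic⇒unblocked : ∀ {n} (up : Fin n → Fin n → Bool) →
  (∀ u → ¬ TransClosure (λ a b → up a b ≡ true) u u) → Unblocked up
acyclic⇒unblocked {n} up acyclic placed x px = ready-vertex
  where
    Step : Fin n → Fin n → Set
    Step a b = up a b ≡ true

    Ready : Fin n → Set
    Ready y = placed y ≡ false × (∀ v → up y v ≡ true → placed v ≡ true)

    escape? : ∀ w → Dec (∃ λ v → up w v ≡ true × placed v ≡ false)
    escape? w = any? (λ v → (up w v Bool.≟ true) ×-dec (placed v Bool.≟ false))

    successor : Fin n → Fin n
    successor w with escape? w
    ... | yes (v , _) = v
    ... | no _ = w

    successor-spec : ∀ w → (Step w (successor w) × placed (successor w) ≡ false)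
                           ⊎ (∀ v → up w v ≡ true → placed v ≡ true)
    successor-spec w with escape? w
    ... | yes (v , s , pv) = inj₁ (s , pv)
    ... | no none = inj₂ λ v s → Boolₚ.¬-not (λ pv → none (v , s , pv))

    walk : ℕ → Fin n
    walk zero = x
    walk (suc i) = successor (walk i)

    walk-or-ready : ∀ k → (∃ Ready) ⊎ (placed (walk k) ≡ false × (∀ i → i < k → Step (walk i) (walk (suc i))))
    walk-or-ready zero = inj₂ (px , λ _ ())
    walk-or-ready (suc k) with walk-or-ready k
    ... | inj₁ found = inj₁ found
    ... | inj₂ (pk , steps) with successor-spec (walk k)
    ...   | inj₂ ready = inj₁ (walk k , pk , ready)
    ...   | inj₁ (s , ps) = inj₂ (ps , extended)
      where
        extended : ∀ i → i < suc k → Step (walk i) (walk (suc i))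
        extended i (s≤s i≤k) with ℕₚ.m≤n⇒m<n∨m≡n i≤k
        ... | inj₁ i<k = steps i i<k
        ... | inj₂ refl = s

    path : ∀ a b → a < b → (∀ i → i < b → Step (walk i) (walk (suc i))) →
           TransClosure Step (walk a) (walk b)
    path a (suc b) (s≤s a≤b) steps with ℕₚ.m≤n⇒m<n∨m≡n a≤b
    ... | inj₂ refl = [ steps a ℕₚ.≤-refl ]
    ... | inj₁ a<b = path a b a<b (λ i i<b → steps i (ℕₚ.m≤n⇒m≤1+n i<b)) ∷ʳ steps b ℕₚ.≤-refl

    ready-vertex : ∃ Ready
    ready-vertex with walk-or-ready n
    ... | inj₁ found = found
    ... | inj₂ (_ , steps) with pigeonhole ℕₚ.≤-refl (walk ∘ toℕ)
    ...   | i , j , i<j , same = ⊥-elim (acyclic (walk (toℕ i))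
              (subst (TransClosure Step (walk (toℕ i))) (sym same)
                 (path (toℕ i) (toℕ j) i<j (λ k k<j → steps k (ℕₚ.≤-trans k<j (ℕₚ.≤-pred (toℕ<n j)))))))

module GreedyOrder {n : ℕ} (up : Fin n → Fin n → Bool) (unblocked : Unblocked up) where

  Placement : Set
  Placement = Fin n → Maybe ℕ

  Placed : Maybe ℕ → Set
  Placed m = ∃ λ k → m ≡ just k

  placed? : ∀ m → Dec (Placed m)
  placed? nothing = no λ ()
  placed? (just k) = yes (k , refl)

  Ready : Placement → Fin n → Set
  Ready s x = s x ≡ nothing × (∀ v → up x v ≡ true → Placed (s v))

  ready? : ∀ s x → Dec (Ready s x)
  ready? s x = Maybeₚ.≡-dec ℕ._≟_ (s x) nothing
               ×-dec all? (λ v → (up x v Bool.≟ true) →-dec placed? (s v))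

  upPositions : Placement → Fin n → Fin n → Maybe ℕ
  upPositions s x v = if up x v then s v else nothing

  anchorIn : Placement → Fin n → ℕ
  anchorIn s x = Maybe.maybe proj₂ 0 (maxArg (upPositions s x))

  score : Placement → Fin n → Maybe ℕ
  score s x with ready? s x
  ... | yes _ = just (anchorIn s x * n + toℕ x)
  ... | no _ = nothing

  score-ready : ∀ s x → Ready s x → score s x ≡ just (anchorIn s x * n + toℕ x)
  score-ready s x r with ready? s x
  ... | yes _ = refl
  ... | no ¬r = contradiction r ¬r

  score-just : ∀ s x {sc} → score s x ≡ just sc → Ready s x × sc ≡ anchorIn s x * n + toℕ x
  score-just s x e with ready? s x
  score-just s x refl | yes r = r , refl

  choose : Placement → Maybe (Fin n × ℕ)
  choose s = maxArg (score s)

  place : Placement → Fin n → ℕ → Placement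
  place s x k y = if does (y F.≟ x) then just k else s y

  advance : ℕ → Placement → Maybe (Fin n × ℕ) → Placement
  advance t s nothing = s
  advance t s (just (x , _)) = place s x (suc t)

  stage : ℕ → Placement
  stage zero _ = nothing
  stage (suc t) = advance t (stage t) (choose (stage t))

  Chosen : ℕ → Fin n → Set
  Chosen t x = ∃ λ sc → choose (stage t) ≡ just (x , sc)

  chosen-placed : ∀ t {x} → Chosen t x → stage (suc t) x ≡ just (suc t)
  chosen-placed t {x} (_ , e) rewrite e with x F.≟ x
  ... | yes _ = refl
  ... | no x≢x = contradiction refl x≢x

  chosen-ready : ∀ t {x} → Chosen t x → Ready (stage t) x
  chosen-ready t {x} (_ , e) = proj₁ (score-just (stage t) x (proj₁ (maxArg-just (score (stage t)) e)))

  data StepCase (t : ℕ) (y : Fin n) : Set where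
    kept      : stage (suc t) y ≡ stage t y → StepCase t y
    placedNow : Chosen t y → stage (suc t) y ≡ just (suc t) → StepCase t y

  step-case : ∀ t y → StepCase t y
  step-case t y with choose (stage t) in e
  ... | nothing = kept (cong (λ c → advance t (stage t) c y) e)
  ... | just (x , sc) with y F.≟ x
  ...   | yes refl = placedNow (sc , e) (chosen-placed t (sc , e))
  ...   | no y≢x = kept (trans (cong (λ c → advance t (stage t) c y) e) (place-other y≢x))
    where
      place-other : y ≢ x → place (stage t) x (suc t) y ≡ stage t y
      place-other y≢x with y F.≟ x
      ... | yes y≡x = contradiction y≡x y≢x
      ... | no _ = refl

  stage-bounds : ∀ t x {k} → stage t x ≡ just k → 0 < k × k ≤ t
  stage-bounds zero x ()
  stage-bounds (suc t) x e with step-case t x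
  ... | kept s = let (0<k , k≤t) = stage-bounds t x (trans (sym s) e) in 0<k , ℕₚ.m≤n⇒m≤1+n k≤t
  ... | placedNow _ s with trans (sym s) e
  ... | refl = s≤s z≤n , ℕₚ.≤-refl

  stage-injective : ∀ t x y {k} → stage t x ≡ just k → stage t y ≡ just k → x ≡ y
  stage-injective zero x y ()
  stage-injective (suc t) x y ex ey with step-case t x | step-case t y
  ... | kept sx | kept sy = stage-injective t x y (trans (sym sx) ex) (trans (sym sy) ey)
  ... | placedNow _ nx | kept sy with trans (sym nx) ex
  ...   | refl = contradiction (proj₂ (stage-bounds t y (trans (sym sy) ey))) (ℕₚ.<-irrefl refl)
  stage-injective (suc t) x y ex ey | kept sx | placedNow _ ny with trans (sym ny) ey
  ...   | refl = contradiction (proj₂ (stage-bounds t x (trans (sym sx) ex))) (ℕₚ.<-irrefl refl)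
  stage-injective (suc t) x y ex ey | placedNow (_ , cx) _ | placedNow (_ , cy) _ =
    cong proj₁ (just-injective (trans (sym cx) cy))

  stage-step : ∀ t x {k} → stage t x ≡ just k → stage (suc t) x ≡ just k
  stage-step t x e with step-case t x
  ... | kept s = trans s e
  ... | placedNow c _ = nothing≢just (trans (sym (proj₁ (chosen-ready t c))) e)

  stage-mono : ∀ t t' x {k} → t ≤ t' → stage t x ≡ just k → stage t' x ≡ just k
  stage-mono t zero x z≤n e = e
  stage-mono t (suc t') x t≤t' e with ℕₚ.m≤n⇒m<n∨m≡n t≤t'
  ... | inj₂ refl = e
  ... | inj₁ (s≤s t≤t'') = stage-step t' x (stage-mono t t' x t≤t'' e)

  all-placed⇒n≤t : ∀ t → (∀ x → Placed (stage t x)) → n ≤ t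
  all-placed⇒n≤t t placed = ℕₚ.≮⇒≥ λ t<n →
    let (i , j , i<j , same) = pigeonhole t<n slot in ℕₚ.<⇒≢ i<j (cong toℕ (slot-injective same))
    where
      bounds : ∀ x → 0 < proj₁ (placed x) × proj₁ (placed x) ≤ t
      bounds x = stage-bounds t x (proj₂ (placed x))

      slot : Fin n → Fin t
      slot x = fromℕ< (pred<t (bounds x))
        where pred<t : ∀ {k} → 0 < k × k ≤ t → ℕ.pred k < t
              pred<t (s≤s z≤n , k≤t) = k≤t

      slot-injective : ∀ {x y} → slot x ≡ slot y → x ≡ y
      slot-injective {x} {y} same = stage-injective t x y (proj₂ (placed x))
        (subst (λ k → stage t y ≡ just k)
          (pred-injective (proj₁ (bounds y)) (proj₁ (bounds x))
            (trans (sym (toℕ-fromℕ< _)) (trans (cong toℕ (sym same)) (toℕ-fromℕ< _))))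
          (proj₂ (placed y)))

  unplaced-exists : ∀ t → t < n → ∃ λ x → stage t x ≡ nothing
  unplaced-exists t t<n with any? (λ x → Maybeₚ.≡-dec ℕ._≟_ (stage t x) nothing)
  ... | yes found = found
  ... | no none = contradiction (all-placed⇒n≤t t placedAt) (ℕₚ.<⇒≱ t<n)
    where
      placedAt : ∀ x → Placed (stage t x)
      placedAt x with stage t x in e
      ... | just k = k , refl
      ... | nothing = ⊥-elim (none (x , e))

  choose-succeeds : ∀ t → t < n → ∃ λ x → Chosen t x
  choose-succeeds t t<n with unplaced-exists t t<n
  ... | x , x-unplaced with unblocked (is-just ∘ stage t) x (cong is-just x-unplaced)
  ... | y , y-unplaced , ups-placed with choose (stage t) in e
  ...   | just (x' , sc) = x' , sc , refl
  ...   | nothing = nothing≢just (trans (sym (maxArg-nothing (score (stage t)) e y))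
                                          (score-ready (stage t) y y-ready))
    where
      nothing-of : ∀ (m : Maybe ℕ) → is-just m ≡ false → m ≡ nothing
      nothing-of nothing _ = refl

      placed-of : ∀ (m : Maybe ℕ) → is-just m ≡ true → Placed m
      placed-of (just k) _ = k , refl

      y-ready : Ready (stage t) y
      y-ready = nothing-of (stage t y) y-unplaced , λ v u → placed-of (stage t v) (ups-placed v u)

  stage-covers : ∀ t → t ≤ n → ∀ k → 0 < k → k ≤ t → ∃ λ x → stage t x ≡ just k
  stage-covers zero _ k (s≤s _) ()
  stage-covers (suc t) t<n k 0<k k≤1+t with ℕₚ.m≤n⇒m<n∨m≡n k≤1+t
  ... | inj₁ (s≤s k≤t) = let (x , e) = stage-covers t (ℕₚ.<⇒≤ t<n) k 0<k k≤t in x , stage-step t x e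
  ... | inj₂ refl = let (x , c) = choose-succeeds t t<n in x , chosen-placed t c

  occupant : Fin n → Fin n
  occupant i = proj₁ (stage-covers n ℕₚ.≤-refl (suc (toℕ i)) (s≤s z≤n) (toℕ<n i))

  occupant-stage : ∀ i → stage n (occupant i) ≡ just (suc (toℕ i))
  occupant-stage i = proj₂ (stage-covers n ℕₚ.≤-refl (suc (toℕ i)) (s≤s z≤n) (toℕ<n i))

  -- After n stages every vertex is placed: the n occupants together with an
  -- unplaced vertex would be n+1 distinct vertices.
  placed-final : ∀ x → Placed (stage n x)
  placed-final x with stage n x in e
  ... | just k = k , refl
  ... | nothing = ⊥-elim (all-distinct (pigeonhole ℕₚ.≤-refl candidate))
    where
      candidate : Fin (suc n) → Fin n
      candidate F.zero = x
      candidate (F.suc i) = occupant i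

      all-distinct : ¬ ∃ λ i → ∃ λ j → i F.< j × candidate i ≡ candidate j
      all-distinct (F.zero , F.suc j , _ , same) =
        nothing≢just (trans (sym e) (trans (cong (stage n) same) (occupant-stage j)))
      all-distinct (F.suc i , F.suc j , s≤s i<j , same) = ℕₚ.<⇒≢ i<j (ℕₚ.suc-injective
        (just-injective (trans (sym (occupant-stage i)) (trans (cong (stage n) same) (occupant-stage j)))))

  pos : Fin n → ℕ
  pos x = proj₁ (placed-final x)

  pos-stage : ∀ x → stage n x ≡ just (pos x)
  pos-stage x = proj₂ (placed-final x)

  pos-bounds : ∀ x → 0 < pos x × pos x ≤ n
  pos-bounds x = stage-bounds n x (pos-stage x)

  pos-injective : ∀ x y → pos x ≡ pos y → x ≡ y
  pos-injective x y e = stage-injective n x y (pos-stage x) (trans (pos-stage y) (cong just (sym e)))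

  pos-onto : ∀ k → 0 < k → k ≤ n → ∃ λ x → pos x ≡ k
  pos-onto k 0<k k≤n = let (x , e) = stage-covers n ℕₚ.≤-refl k 0<k k≤n in
    x , just-injective (trans (sym (pos-stage x)) e)

  pos-suc : ∀ x → ∃ λ t → pos x ≡ suc t
  pos-suc x with pos x | pos-bounds x
  ... | suc t | _ = t , refl

  stage-pos : ∀ t x {k} → t ≤ n → stage t x ≡ just k → pos x ≡ k
  stage-pos t x t≤n e = just-injective (trans (sym (pos-stage x)) (stage-mono t n x t≤n e))

  stage-late : ∀ t t' x {k} → t ≤ t' → stage t x ≡ nothing → stage t' x ≡ just k → t < k
  stage-late t zero x z≤n e e' = nothing≢just (trans (sym e) e')
  stage-late t (suc t') x t≤1+t' e e' with ℕₚ.m≤n⇒m<n∨m≡n t≤1+t'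
  ... | inj₂ refl = nothing≢just (trans (sym e) e')
  ... | inj₁ (s≤s t≤t') with step-case t' x
  ...   | kept s = stage-late t t' x t≤t' e (trans (sym s) e')
  ...   | placedNow _ s with trans (sym s) e'
  ...     | refl = s≤s t≤t'

  stage-after : ∀ t x → t ≤ n → pos x ≤ t → stage t x ≡ just (pos x)
  stage-after t x t≤n pos≤t with stage t x in e
  ... | just k = cong just (sym (stage-pos t x t≤n e))
  ... | nothing = contradiction pos≤t (ℕₚ.<⇒≱ (stage-late t n x t≤n e (pos-stage x)))

  stage-before : ∀ t x → t ≤ n → t < pos x → stage t x ≡ nothing
  stage-before t x t≤n t<pos with stage t x in e
  ... | nothing = refl
  ... | just k = contradiction (subst (_≤ t) (sym (stage-pos t x t≤n e)) (proj₂ (stage-bounds t x e)))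
                               (ℕₚ.<⇒≱ t<pos)

  chosen-at : ∀ t x → pos x ≡ suc t → Chosen t x
  chosen-at t x e with step-case t x
  ... | placedNow c _ = c
  ... | kept s = nothing≢just (trans (sym (stage-before t x t≤n (ℕₚ.≤-reflexive (sym e))))
                                     (trans (sym s) (trans (stage-after (suc t) x 1+t≤n (ℕₚ.≤-reflexive e)) (cong just e))))
    where
      1+t≤n : suc t ≤ n
      1+t≤n = subst (_≤ n) e (proj₂ (pos-bounds x))
      t≤n : t ≤ n
      t≤n = ℕₚ.<⇒≤ 1+t≤n

  pos-up : ∀ x v → up x v ≡ true → pos v < pos x
  pos-up x v u with pos-suc x
  ... | t , e with proj₂ (chosen-ready t (chosen-at t x e)) v u
  ...   | k , ek = subst (pos v <_) (sym e) (s≤s (subst (_≤ t) (sym (stage-pos t v t≤n ek)) (proj₂ (stage-bounds t v ek))))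
    where
      t≤n : t ≤ n
      t≤n = ℕₚ.<⇒≤ (subst (_≤ n) e (proj₂ (pos-bounds x)))

  anchor : Fin n → ℕ
  anchor = anchorIn (stage n)

  top : Fin n → V n
  top x = Maybe.map proj₁ (maxArg (upPositions (stage n) x))

  P : V n → ℕ
  P nothing = 0
  P (just x) = pos x

  upPositions-just : ∀ s x v {k} → upPositions s x v ≡ just k → up x v ≡ true × s v ≡ just k
  upPositions-just s x v e with up x v
  ... | true = refl , e

  upPositions-up : ∀ s x v → up x v ≡ true → upPositions s x v ≡ s v
  upPositions-up s x v u rewrite u = refl

  anchor-top : ∀ x → anchor x ≡ P (top x)
  anchor-top x with maxArg (upPositions (stage n) x) | maxArg-spec (upPositions (stage n) x)
  ... | nothing | _ = refl
  ... | just (v , k) | attained .v .k e _ = just-injective (trans (sym (proj₂ (upPositions-just (stage n) x v e))) (pos-stage v))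

  top-up : ∀ x k → top x ≡ just k → up x k ≡ true
  top-up x k e with maxArg (upPositions (stage n) x) | maxArg-spec (upPositions (stage n) x)
  top-up x k refl | just (.k , _) | attained .k _ e _ = proj₁ (upPositions-just (stage n) x k e)

  anchor-max : ∀ x v → up x v ≡ true → pos v ≤ anchor x
  anchor-max x v u with maxArg (upPositions (stage n) x) | maxArg-spec (upPositions (stage n) x)
  ... | nothing | undefined none = nothing≢just (trans (sym (none v)) (trans (upPositions-up (stage n) x v u) (pos-stage v)))
  ... | just _ | attained _ _ _ max = max v (pos v) (trans (upPositions-up (stage n) x v u) (pos-stage v))

  anchor<pos : ∀ x → anchor x < pos x
  anchor<pos x with maxArg (upPositions (stage n) x) | maxArg-spec (upPositions (stage n) x)
  ... | nothing | _ = proj₁ (pos-bounds x)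
  ... | just (v , k) | attained .v .k e _ with upPositions-just (stage n) x v e
  ...   | u , ek = subst (_< pos x) (just-injective (trans (sym (pos-stage v)) ek)) (pos-up x v u)

  anchor-stable : ∀ t x → t ≤ n → (∀ v → up x v ≡ true → pos v ≤ t) → anchorIn (stage t) x ≡ anchor x
  anchor-stable t x t≤n early = cong (Maybe.maybe proj₂ 0) (maxArg-cong _ _ agree)
    where
      agree : ∀ v → upPositions (stage t) x v ≡ upPositions (stage n) x v
      agree v with up x v in u
      ... | true = trans (stage-after t v t≤n (early v u)) (sym (pos-stage v))
      ... | false = refl

  -- The greedy property: if x is placed before y and y's anchor before x,
  -- then y was ready when x was chosen, so (anchor y, y) ≤ (anchor x, x).
  greedy : ∀ x y → pos x < pos y → anchor y < pos x →
           anchor y < anchor x ⊎ (anchor y ≡ anchor x × toℕ y < toℕ x)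
  greedy x y x<y y-anchored with pos-suc x
  ... | t , e = subst₂ (λ a b → a < b ⊎ (a ≡ b × toℕ y < toℕ x)) (stable y y-early) (stable x x-early)
                  (lex-decode n _ _ y x score-y≤score-x y≢x)
    where
      t≤n : t ≤ n
      t≤n = ℕₚ.<⇒≤ (subst (_≤ n) e (proj₂ (pos-bounds x)))

      y≢x : y ≢ x
      y≢x refl = ℕₚ.<-irrefl refl x<y

      y-early : ∀ v → up y v ≡ true → pos v ≤ t
      y-early v u = ℕₚ.≤-pred (subst (pos v <_) e (ℕₚ.≤-<-trans (anchor-max y v u) y-anchored))

      x-early : ∀ v → up x v ≡ true → pos v ≤ t
      x-early v u = ℕₚ.≤-pred (subst (pos v <_) e (pos-up x v u))

      stable : ∀ z → (∀ v → up z v ≡ true → pos v ≤ t) → anchorIn (stage t) z ≡ anchor z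
      stable z = anchor-stable t z t≤n

      y-ready : Ready (stage t) y
      y-ready = stage-before t y t≤n (ℕₚ.<-trans (ℕₚ.≤-reflexive (sym e)) x<y)
              , λ v u → pos v , stage-after t v t≤n (y-early v u)

      x-chosen : Chosen t x
      x-chosen = chosen-at t x e

      score-y≤score-x : anchorIn (stage t) y * n + toℕ y ≤ anchorIn (stage t) x * n + toℕ x
      score-y≤score-x with maxArg-just (score (stage t)) (proj₂ x-chosen)
      ... | score-x , max = subst (_ ≤_) (proj₂ (score-just (stage t) x score-x))
                              (max y _ (score-ready (stage t) y y-ready))

  P≤n : ∀ v → P v ≤ n
  P≤n nothing = z≤n
  P≤n (just x) = proj₂ (pos-bounds x)

  label : V n → Fin (suc n)
  label v = fromℕ< (s≤s (P≤n v))

  toℕ-label : ∀ v → toℕ (label v) ≡ P v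
  toℕ-label v = toℕ-fromℕ< _

  label-< : ∀ a b → P a < P b → label a <F label b
  label-< a b = subst₂ _<_ (sym (toℕ-label a)) (sym (toℕ-label b))

  <-label : ∀ a b → label a <F label b → P a < P b
  <-label a b = subst₂ _<_ (toℕ-label a) (toℕ-label b)

  label-injective : Injective _≡_ _≡_ label
  label-injective {a} {b} e = P-injective a b (trans (sym (toℕ-label a)) (trans (cong toℕ e) (toℕ-label b)))
    where
      P-injective : ∀ a b → P a ≡ P b → a ≡ b
      P-injective nothing nothing _ = refl
      P-injective nothing (just y) e = contradiction e (ℕₚ.<⇒≢ (proj₁ (pos-bounds y)))
      P-injective (just x) nothing e = contradiction (sym e) (ℕₚ.<⇒≢ (proj₁ (pos-bounds x)))
      P-injective (just x) (just y) e = cong just (pos-injective x y e)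

  label-surjective : Surjective _≡_ _≡_ label
  label-surjective F.zero = nothing , λ { refl → refl }
  label-surjective (F.suc i) = just x , λ { refl → toℕ-injective (trans (toℕ-label (just x)) pos-x) }
    where
      x = proj₁ (pos-onto (suc (toℕ i)) (s≤s z≤n) (toℕ<n i))
      pos-x = proj₂ (pos-onto (suc (toℕ i)) (s≤s z≤n) (toℕ<n i))

  -- If the parent of every vertex of T is its top up-neighbour, the greedy
  -- labels are a p_T: the greedy property gives the sibling order and
  -- excludes crossing edges.
  label-isPT : ∀ {G : SimpleGraph n} (T : RootedTree G) → (∀ x → top x ≡ par T x) → IsPT T label
  label-isPT T top≡par = (label-injective , label-surjective) , below-parent , siblings , non-crossing
    where
      anchor-par : ∀ x → anchor x ≡ P (par T x)
      anchor-par x = trans (anchor-top x) (cong P (top≡par x))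

      below-parent : ∀ i → label (par T i) <F label (just i)
      below-parent i = label-< (par T i) (just i) (subst (_< pos i) (anchor-par i) (anchor<pos i))

      siblings : ∀ i j → par T i ≡ par T j → i <F j → label (just j) <F label (just i)
      siblings i j same i<j = label-< (just j) (just i) j-first
        where
          same-anchor : anchor j ≡ anchor i
          same-anchor = trans (anchor-par j) (trans (cong P (sym same)) (sym (anchor-par i)))

          j-first : pos j < pos i
          j-first with ℕₚ.<-cmp (pos i) (pos j)
          ... | tri> _ _ j<i = j<i
          ... | tri≈ _ eq _ = contradiction (cong toℕ (pos-injective i j eq)) (ℕₚ.<⇒≢ i<j)
          ... | tri< i<j' _ _ with greedy i j i<j' (subst (_< pos i) (sym same-anchor) (anchor<pos i))
          ...   | inj₁ lower = contradiction same-anchor (ℕₚ.<⇒≢ lower)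
          ...   | inj₂ (_ , j<i) = contradiction i<j (ℕₚ.<⇒≯ j<i)

      anchors< : ∀ i i' → label (par T i) <F label (par T i') → anchor i < anchor i'
      anchors< i i' lt = subst₂ _<_ (sym (anchor-par i)) (sym (anchor-par i')) (<-label (par T i) (par T i') lt)

      non-crossing : ∀ i i' → ¬ (label (par T i) <F label (par T i')
                                  × label (par T i') <F label (just i)
                                  × label (just i) <F label (just i'))
      non-crossing i i' (a , b , c) with greedy i i' (<-label (just i) (just i') c)
                                            (subst (_< pos i) (sym (anchor-par i')) (<-label (par T i') (just i) b))
      ... | inj₁ lower = ℕₚ.<-asym lower (anchors< i i' a)
      ... | inj₂ (eq , _) = ℕₚ.<-irrefl (sym eq) (anchors< i i' a)

module TreeLabelling {n} {G : SimpleGraph n} (T : RootedTree G) where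

  parentOf : Fin n → Fin n → Bool
  parentOf x v = does (Maybeₚ.≡-dec F._≟_ (par T x) (just v))

  parentOf-true : ∀ {x v} → parentOf x v ≡ true → par T x ≡ just v
  parentOf-true {x} {v} = holds (Maybeₚ.≡-dec F._≟_ (par T x) (just v))

  -- climbing from an unplaced vertex towards the root, the last unplaced
  -- vertex met has its parent placed (or is a child of the root)
  parent-unblocked : Unblocked parentOf
  parent-unblocked placed x px = ascend (proj₁ (reaches T x)) x (proj₂ (reaches T x)) px
    where
      ascend : ∀ m x → climb (par T) m (just x) ≡ nothing → placed x ≡ false →
               ∃ λ y → placed y ≡ false × (∀ v → parentOf y v ≡ true → placed v ≡ true)
      ascend zero x () _
      ascend (suc m) x reach px with par T x in e
      ... | nothing = x , px , λ v u → nothing≢just (trans (sym e) (parentOf-true u))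
      ... | just k with placed k in pk
      ...   | true = x , px , λ v u → subst (λ z → placed z ≡ true) (just-injective (trans (sym e) (parentOf-true u))) pk
      ...   | false = ascend m k reach pk

  open GreedyOrder parentOf parent-unblocked

  top-is-parent : ∀ x → top x ≡ par T x
  top-is-parent x with maxArg (upPositions (stage n) x) | maxArg-spec (upPositions (stage n) x)
  ... | just (v , k) | attained .v .k fv _ = sym (parentOf-true (proj₁ (upPositions-just (stage n) x v fv)))
  ... | nothing | undefined none = sym (root (par T x) refl)
    where
      root : ∀ m → par T x ≡ m → par T x ≡ nothing
      root nothing e = e
      root (just k) e = nothing≢just (trans (sym (none k))
        (trans (upPositions-up (stage n) x k (dec-true (Maybeₚ.≡-dec F._≟_ (par T x) (just k)) e)) (pos-stage k)))

  labelling : ∃ λ p → IsPT T p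
  labelling = label , label-isPT T top-is-parent

module LabelFacts {n} {G : SimpleGraph n} (T : RootedTree G) (p : V n → Fin (suc n)) (isPT : IsPT T p) where

  ℓ : V n → ℕ
  ℓ v = toℕ (p v)

  ℓ-injective : ∀ u v → ℓ u ≡ ℓ v → u ≡ v
  ℓ-injective u v e = proj₁ (proj₁ isPT) (toℕ-injective e)

  p-surjective : Surjective _≡_ _≡_ p
  p-surjective = proj₂ (proj₁ isPT)

  below-parent : ∀ i → ℓ (par T i) < ℓ (just i)
  below-parent = proj₁ (proj₂ isPT)

  siblings : ∀ i j → par T i ≡ par T j → toℕ i < toℕ j → ℓ (just j) < ℓ (just i)
  siblings = proj₁ (proj₂ (proj₂ isPT))

  non-crossing : ∀ i i' → ¬ (ℓ (par T i) < ℓ (par T i') × ℓ (par T i') < ℓ (just i) × ℓ (just i) < ℓ (just i'))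
  non-crossing = proj₂ (proj₂ (proj₂ isPT))

  -- the root is the only vertex that is nobody's child, so it gets label 0
  root-label : ℓ nothing ≡ 0
  root-label with p-surjective F.zero
  ... | nothing , h = cong toℕ (h refl)
  ... | just i , h = contradiction (subst (ℓ (par T i) <_) (cong toℕ (h refl)) (below-parent i)) ℕₚ.n≮0

  vertex-label : ∀ i → 0 < ℓ (just i)
  vertex-label i = ℕₚ.≤-<-trans z≤n (below-parent i)

  -- m ↦ n+1-p(m) is a bijection [n] → [n] (as Fin n, shifted down by one)
  -- that reverses the order of the labels.
  reversed : ∃ λ f → (∀ m → suc (toℕ (f m)) ≡ suc n ∸ ℓ (just m))
                   × Bijective _≡_ _≡_ f
                   × (∀ u v → ℓ (just v) < ℓ (just u) → f u <F f v)
  reversed = f , shifted , (f-injective , f-surjective) , f-reverses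
    where
      ℓ≤n : ∀ m → ℓ (just m) ≤ n
      ℓ≤n m = ℕₚ.≤-pred (toℕ<n (p (just m)))

      n∸ℓ<n : ∀ m → n ∸ ℓ (just m) < n
      n∸ℓ<n m with ℓ (just m) | vertex-label m | ℓ≤n m
      ... | suc k | _ | s≤s k<n = s≤s (ℕₚ.m∸n≤m _ k)

      f : Fin n → Fin n
      f m = fromℕ< (n∸ℓ<n m)

      toℕ-f : ∀ m → toℕ (f m) ≡ n ∸ ℓ (just m)
      toℕ-f m = toℕ-fromℕ< (n∸ℓ<n m)

      shifted : ∀ m → suc (toℕ (f m)) ≡ suc n ∸ ℓ (just m)
      shifted m = trans (cong suc (toℕ-f m)) (sym (ℕₚ.+-∸-assoc 1 (ℓ≤n m)))

      f-injective : Injective _≡_ _≡_ f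
      f-injective {a} {b} e = just-injective (ℓ-injective _ _
        (ℕₚ.∸-cancelˡ-≡ (ℓ≤n a) (ℓ≤n b) (trans (sym (toℕ-f a)) (trans (cong toℕ e) (toℕ-f b)))))

      f-surjective : Surjective _≡_ _≡_ f
      f-surjective y with p-surjective (fromℕ< (s≤s (ℕₚ.m∸n≤m n (toℕ y))))
      ... | v , hits = m , λ { refl → toℕ-injective (trans (toℕ-f m) (trans (cong (n ∸_) ℓm) (ℕₚ.m∸[m∸n]≡n (ℕₚ.<⇒≤ (toℕ<n y))))) }
        where
          ℓv : ℓ v ≡ n ∸ toℕ y
          ℓv = trans (cong toℕ (hits refl)) (toℕ-fromℕ< _)

          vertex : ∀ v → ℓ v ≡ n ∸ toℕ y → ∃ λ m → ℓ (just m) ≡ n ∸ toℕ y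
          vertex nothing e = contradiction (trans (sym root-label) e) (ℕₚ.<⇒≢ (ℕₚ.m<n⇒0<n∸m (toℕ<n y)))
          vertex (just m) e = m , e

          m = proj₁ (vertex v ℓv)
          ℓm = proj₂ (vertex v ℓv)

      f-reverses : ∀ u v → ℓ (just v) < ℓ (just u) → f u <F f v
      f-reverses u v lt = subst₂ _<_ (sym (toℕ-f u)) (sym (toℕ-f v)) (ℕₚ.∸-monoʳ-< lt (ℓ≤n u))

  dfs-order : ∀ x y → ℓ (just x) < ℓ (just y) → ℓ (par T y) < ℓ (just x) →
              ℓ (par T y) < ℓ (par T x) ⊎ (par T y ≡ par T x × toℕ y < toℕ x)
  dfs-order x y x<y py<x with Maybeₚ.≡-dec F._≟_ (par T y) (par T x)
  ... | no different with ℕₚ.<-cmp (ℓ (par T y)) (ℓ (par T x))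
  ...   | tri< lt _ _ = inj₁ lt
  ...   | tri≈ _ eq _ = contradiction (ℓ-injective _ _ eq) different
  ...   | tri> _ _ gt = contradiction (gt , py<x , x<y) (non-crossing x y)
  dfs-order x y x<y py<x | yes same with ℕₚ.<-cmp (toℕ y) (toℕ x)
  ...   | tri< lt _ _ = inj₂ (same , lt)
  ...   | tri≈ _ eq _ = contradiction (cong ℓ (cong just (toℕ-injective eq))) (ℕₚ.>⇒≢ x<y)
  ...   | tri> _ _ gt = contradiction (siblings x y (sym same) gt) (ℕₚ.<⇒≯ x<y)

-- Two labellings p (of T) and q (of T') coincide, provided that whenever
-- they agree below level t, every vertex at level t has the same parent in
-- T and T'.  Proof: by strong induction on t, the vertex at level t is the
-- same for p and q; otherwise dfs-order, applied in both trees, contradicts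
-- itself.

module Agreement {n} {G : SimpleGraph n} (T T' : RootedTree G) (p q : V n → Fin (suc n))
                 (isPT-p : IsPT T p) (isPT-q : IsPT T' q) where
  module Lp = LabelFacts T p isPT-p
  module Lq = LabelFacts T' q isPT-q

  AgreeBelow : ℕ → Set
  AgreeBelow t = (∀ u → Lp.ℓ u < t → p u ≡ q u) × (∀ u → Lq.ℓ u < t → p u ≡ q u)

  ParentsAgree : Set
  ParentsAgree = ∀ t → AgreeBelow t → ∀ x → Lp.ℓ (just x) ≡ t ⊎ Lq.ℓ (just x) ≡ t → par T x ≡ par T' x

  SameAt : ℕ → Set
  SameAt t = ∀ v w → Lp.ℓ v ≡ t → Lq.ℓ w ≡ t → v ≡ w

  agree-below : ∀ t → (∀ {s} → s < t → SameAt s) → AgreeBelow t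
  agree-below t same = by-p , by-q
    where
      by-p : ∀ u → Lp.ℓ u < t → p u ≡ q u
      by-p u lt with Lq.p-surjective (p u)
      ... | w , h with same lt u w refl (cong toℕ (h refl))
      ...   | refl = sym (h refl)

      by-q : ∀ u → Lq.ℓ u < t → p u ≡ q u
      by-q u lt with Lp.p-surjective (q u)
      ... | v , h with same lt v u (cong toℕ (h refl)) refl
      ...   | refl = h refl

  module _ (parents-agree : ParentsAgree) where

   no-clash : ∀ t → AgreeBelow t → ∀ x y → Lp.ℓ (just x) ≡ t → Lq.ℓ (just y) ≡ t → x ≢ y → ⊥
   no-clash t (by-p , by-q) x y px≡t qy≡t x≢y = incompatible dfs-p dfs-q
     where
       px< : Lp.ℓ (par T x) < t
       px< = subst (Lp.ℓ (par T x) <_) px≡t (Lp.below-parent x)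

       qy< : Lq.ℓ (par T' y) < t
       qy< = subst (Lq.ℓ (par T' y) <_) qy≡t (Lq.below-parent y)

       ex : Lq.ℓ (par T' x) ≡ Lp.ℓ (par T x)
       ex = trans (cong Lq.ℓ (sym (parents-agree t (by-p , by-q) x (inj₁ px≡t)))) (cong toℕ (sym (by-p _ px<)))

       ey : Lp.ℓ (par T y) ≡ Lq.ℓ (par T' y)
       ey = trans (cong Lp.ℓ (parents-agree t (by-p , by-q) y (inj₂ qy≡t))) (cong toℕ (by-q _ qy<))

       t<py : t < Lp.ℓ (just y)
       t<py with ℕₚ.<-cmp t (Lp.ℓ (just y))
       ... | tri< lt _ _ = lt
       ... | tri≈ _ eq _ = contradiction (just-injective (Lp.ℓ-injective _ _ (trans px≡t eq))) x≢y
       ... | tri> _ _ gt = ⊥-elim (ℕₚ.<-irrefl (trans (cong toℕ (by-p _ gt)) qy≡t) gt)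

       t<qx : t < Lq.ℓ (just x)
       t<qx with ℕₚ.<-cmp t (Lq.ℓ (just x))
       ... | tri< lt _ _ = lt
       ... | tri≈ _ eq _ = contradiction (just-injective (Lq.ℓ-injective _ _ (trans (sym eq) (sym qy≡t)))) x≢y
       ... | tri> _ _ gt = ⊥-elim (ℕₚ.<-irrefl (trans (cong toℕ (sym (by-q _ gt))) px≡t) gt)

       dfs-p = Lp.dfs-order x y (subst (_< Lp.ℓ (just y)) (sym px≡t) t<py)
                                 (subst (_< Lp.ℓ (just x)) (sym ey) (subst (Lq.ℓ (par T' y) <_) (sym px≡t) qy<))
       dfs-q = Lq.dfs-order y x (subst (_< Lq.ℓ (just x)) (sym qy≡t) t<qx)
                                 (subst (_< Lq.ℓ (just y)) (sym ex) (subst (Lp.ℓ (par T x) <_) (sym qy≡t) px<))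

       incompatible : Lp.ℓ (par T y) < Lp.ℓ (par T x) ⊎ (par T y ≡ par T x × toℕ y < toℕ x) →
                      Lq.ℓ (par T' x) < Lq.ℓ (par T' y) ⊎ (par T' x ≡ par T' y × toℕ x < toℕ y) → ⊥
       incompatible (inj₁ a) (inj₁ b) = ℕₚ.<-asym a (subst₂ _<_ ex (sym ey) b)
       incompatible (inj₁ a) (inj₂ (same , _)) = ℕₚ.<-irrefl (trans ey (trans (cong Lq.ℓ (sym same)) ex)) a
       incompatible (inj₂ (same , _)) (inj₁ b) = ℕₚ.<-irrefl (trans ex (trans (cong Lp.ℓ (sym same)) ey)) b
       incompatible (inj₂ (_ , y<x)) (inj₂ (_ , x<y)) = ℕₚ.<-asym y<x x<y

   same-at : ∀ t → (∀ {s} → s < t → SameAt s) → SameAt t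
   same-at t _ nothing nothing _ _ = refl
   same-at t _ nothing (just y) pv qw =
     contradiction (trans qw (trans (sym pv) Lp.root-label)) (ℕₚ.>⇒≢ (Lq.vertex-label y))
   same-at t _ (just x) nothing pv qw =
     contradiction (trans pv (trans (sym qw) Lq.root-label)) (ℕₚ.>⇒≢ (Lp.vertex-label x))
   same-at t ih (just x) (just y) pv qw with x F.≟ y
   ... | yes refl = refl
   ... | no x≢y = ⊥-elim (no-clash t (agree-below t ih) x y pv qw x≢y)

   labels-agree : ∀ v → p v ≡ q v
   labels-agree v = proj₁ (agree-below (suc (Lp.ℓ v)) (λ {s} _ → <-rec SameAt same-at s)) v ℕₚ.≤-refl

pT-unique : ∀ {n} {G : SimpleGraph n} (T : RootedTree G) (p q : V n → Fin (suc n)) →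
            IsPT T p → IsPT T q → ∀ v → p v ≡ q v
pT-unique T p q isPT-p isPT-q = Agreement.labels-agree T T p q isPT-p isPT-q (λ _ _ _ _ → refl)

module Bijection {n} (G : SimpleGraph n) where

  pT : RootedTree G → V n → Fin (suc n)
  pT T = proj₁ (TreeLabelling.labelling T)

  pT-isPT : ∀ T → IsPT T (pT T)
  pT-isPT T = proj₂ (TreeLabelling.labelling T)

  module Facts (T : RootedTree G) = LabelFacts T (pT T) (pT-isPT T)

  lab : RootedTree G → Fin n → ℕ
  lab T u = toℕ (pT T (just u))

  lab-unique : ∀ T p → IsPT T p → ∀ u → lab T u ≡ toℕ (p (just u))
  lab-unique T p isPT u = cong toℕ (pT-unique T (pT T) p (pT-isPT T) isPT (just u))

  towards : RootedTree G → Fin n → Fin n → Bool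
  towards T u v = does ((adj G u v Bool.≟ true) ×-dec (lab T v <? lab T u))

  towards-true : ∀ T {u v} → towards T u v ≡ true → adj G u v ≡ true × lab T v < lab T u
  towards-true T {u} {v} = holds ((adj G u v Bool.≟ true) ×-dec (lab T v <? lab T u))

  towards-intro : ∀ T {u v} → adj G u v ≡ true → lab T v < lab T u → towards T u v ≡ true
  towards-intro T {u} {v} a lt = dec-true ((adj G u v Bool.≟ true) ×-dec (lab T v <? lab T u)) (a , lt)

  towards-false : ∀ T {u v} → ¬ lab T v < lab T u → towards T u v ≡ false
  towards-false T {u} {v} ¬lt = dec-false ((adj G u v Bool.≟ true) ×-dec (lab T v <? lab T u)) (¬lt ∘ proj₂)

  path-decreases : ∀ T {u v} → TransClosure (λ a b → towards T a b ≡ true) u v → lab T v < lab T u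
  path-decreases T [ e ] = proj₂ (towards-true T e)
  path-decreases T (e ∷ rest) = ℕₚ.<-trans (path-decreases T rest) (proj₂ (towards-true T e))

  orientation : RootedTree G → AcyclicOrientation G
  orientation T = record
    { dir = towards T
    ; dir-edge = λ u v e → proj₁ (towards-true T e)
    ; orient = oriented
    ; acyclic = λ u cycle → ℕₚ.<-irrefl refl (path-decreases T cycle)
    }
    where
      oriented : ∀ u v → adj G u v ≡ true → (towards T u v ≡ true × towards T v u ≡ false)
                                         ⊎ (towards T u v ≡ false × towards T v u ≡ true)
      oriented u v a with ℕₚ.<-cmp (lab T v) (lab T u)
      ... | tri< lt _ ngt = inj₁ (towards-intro T a lt , towards-false T ngt)
      ... | tri> nlt _ gt = inj₂ (towards-false T nlt , towards-intro T (trans (SimpleGraph.sym G v u) a) gt)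
      ... | tri≈ _ eq _ with Facts.ℓ-injective T (just v) (just u) eq
      ...   | refl = true≢false (trans (sym a) (irrefl G v))

  Φ : GoodTree G → AcyclicOrientation G
  Φ (T , _) = orientation T

  -- In a good tree every out-neighbour of x is labelled at most its parent:
  -- one strictly between them would be adjacent to x, against the condition.
  out-neighbour≤parent : ∀ (TG : GoodTree G) x j → let T = proj₁ TG in
                         towards T x j ≡ true → lab T j ≤ Facts.ℓ T (par T x)
  out-neighbour≤parent (T , good) x j e with towards-true T e
  ... | a , j<x = ℕₚ.≮⇒≥ λ par<j → true≢false (trans (sym a) (good (pT T) (pT-isPT T) x j par<j j<x))

  parent-edge : ∀ T x k → par T x ≡ just k → towards T x k ≡ true
  parent-edge T x k e = towards-intro T (par-edge T x k e) (subst (λ v → Facts.ℓ T v < lab T x) e (Facts.below-parent T x))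

  data TopOut (d : Fin n → Fin n → Bool) (ℓ : Fin n → ℕ) (x : Fin n) : V n → Set where
    sink : (∀ j → d x j ≡ false) → TopOut d ℓ x nothing
    largest : ∀ k → d x k ≡ true → (∀ j → d x j ≡ true → ℓ j ≤ ℓ k) → TopOut d ℓ x (just k)

  parent-is-top : ∀ (TG : GoodTree G) x → let T = proj₁ TG in TopOut (towards T) (lab T) x (par T x)
  parent-is-top (T , good) x with par T x in e
  ... | just k = largest k (parent-edge T x k e) (λ j d → subst (λ v → lab T j ≤ Facts.ℓ T v) e (out-neighbour≤parent (T , good) x j d))
  ... | nothing = sink no-out
    where
      no-out : ∀ j → towards T x j ≡ false
      no-out j with towards T x j in d
      ... | false = refl
      ... | true = contradiction (subst (λ v → lab T j ≤ Facts.ℓ T v) e (out-neighbour≤parent (T , good) x j d))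
                                 (ℕₚ.<⇒≱ (subst (_< lab T j) (sym (Facts.root-label T)) (Facts.vertex-label T j)))

  top-unique : ∀ {d d' ℓ ℓ' x m m'} → TopOut d ℓ x m → TopOut d' ℓ' x m' →
               (∀ j → d x j ≡ d' x j) → (∀ j → d x j ≡ true → ℓ j ≡ ℓ' j) →
               (∀ j k → ℓ j ≡ ℓ k → j ≡ k) → m ≡ m'
  top-unique (sink _) (sink _) _ _ _ = refl
  top-unique (sink none) (largest k d' _) same _ _ = true≢false (trans (sym d') (trans (sym (same k)) (none k)))
  top-unique (largest k d _) (sink none) same _ _ = true≢false (trans (sym d) (trans (same k) (none k)))
  top-unique (largest k d max) (largest k' d' max') same ℓ≡ℓ' inj =
    cong just (inj k k' (ℕₚ.≤-antisym k≤k' (max k' (trans (same k') d'))))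
    where
      k≤k' = subst₂ _≤_ (sym (ℓ≡ℓ' k d)) (sym (ℓ≡ℓ' k' (trans (same k') d'))) (max' k (trans (sym (same k)) d))

  -- Φ is injective: Agreement applies, since at each level the parents are
  -- the top out-neighbours, whose labels already agree.
  Φ-injective : ∀ TG TG' → (∀ u v → dir (Φ TG) u v ≡ dir (Φ TG') u v) → par (proj₁ TG) ≗ par (proj₁ TG')
  Φ-injective (T , good) (T' , good') same x =
    parents-agree (lab T x) ((λ u _ → labels-agree parents-agree u) , (λ u _ → labels-agree parents-agree u)) x (inj₁ refl)
    where
      open Agreement T T' (pT T) (pT T') (pT-isPT T) (pT-isPT T')

      parents-agree : ParentsAgree
      parents-agree t (by-p , by-q) x level =
        top-unique (parent-is-top (T , good) x) (parent-is-top (T' , good') x) (same x) out-labels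
                   (λ j k e → just-injective (Facts.ℓ-injective T (just j) (just k) e))
        where
          out-labels : ∀ j → towards T x j ≡ true → lab T j ≡ lab T' j
          out-labels j d = cong toℕ (by-level level)
            where
              by-level : Facts.ℓ T (just x) ≡ t ⊎ Facts.ℓ T' (just x) ≡ t → pT T (just j) ≡ pT T' (just j)
              by-level (inj₁ px≡t) = by-p (just j) (subst (lab T j <_) px≡t (proj₂ (towards-true T d)))
              by-level (inj₂ qx≡t) = by-q (just j) (subst (lab T' j <_) qx≡t (proj₂ (towards-true T' (trans (sym (same x j)) d))))

  -- Φ is onto: the greedy placement for O, with each vertex hung from its
  -- top up-neighbour, is a good tree that Φ maps back to O.
  module FromOrientation (O : AcyclicOrientation G) where
    open GreedyOrder (dir O) (acyclic⇒unblocked (dir O) (acyclic O))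

    top-earlier : ∀ x k → top x ≡ just k → pos k < pos x
    top-earlier x k e = subst (_< pos x) (trans (anchor-top x) (cong P e)) (anchor<pos x)

    -- parents come strictly earlier, so climbing reaches the root
    climb-to-root : ∀ b x → pos x < b → ∃ λ m → climb top m (just x) ≡ nothing
    climb-to-root (suc b) x (s≤s pos≤b) with top x in e
    ... | nothing = 1 , e
    ... | just k with climb-to-root b k (ℕₚ.<-≤-trans (top-earlier x k e) pos≤b)
    ...   | m , reached = suc m , subst (λ v → climb top m v ≡ nothing) (sym e) reached

    tree : RootedTree G
    tree = record
      { par = top
      ; par-edge = λ i k e → dir-edge O i k (top-up i k e)
      ; reaches = λ x → climb-to-root (suc (pos x)) x ℕₚ.≤-refl
      }

    tree-isPT : IsPT tree label
    tree-isPT = label-isPT tree (λ _ → refl)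

    lab≡pos : ∀ u → lab tree u ≡ pos u
    lab≡pos u = trans (lab-unique tree label tree-isPT u) (toℕ-label (just u))

    -- a neighbour j of i strictly between top i and i would be an
    -- out-neighbour later than top i, or an in-neighbour later than i
    between-not-adjacent : ∀ i j → P (top i) < pos j → pos j < pos i → adj G i j ≡ false
    between-not-adjacent i j top<j j<i with adj G i j in a
    ... | false = refl
    ... | true with orient O i j a
    ...   | inj₁ (i→j , _) = contradiction (anchor-max i j i→j) (ℕₚ.<⇒≱ (subst (_< pos j) (sym (anchor-top i)) top<j))
    ...   | inj₂ (_ , j→i) = contradiction (pos-up j i j→i) (ℕₚ.<⇒≯ j<i)

    good : ∀ p → IsPT tree p → Condition tree p
    good p isPT i j top<j j<i = between-not-adjacent i j (subst₂ _<_ (ℓ≡P (top i)) (ℓ≡P (just j)) top<j)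
                                                         (subst₂ _<_ (ℓ≡P (just j)) (ℓ≡P (just i)) j<i)
      where
        ℓ≡P : ∀ v → toℕ (p v) ≡ P v
        ℓ≡P v = trans (cong toℕ (pT-unique tree p label isPT tree-isPT v)) (toℕ-label v)

    -- Φ(tree) = O: both orient each edge towards the earlier-placed endpoint
    realises : ∀ u v → towards tree u v ≡ dir O u v
    realises u v with dir O u v in d
    ... | true = towards-intro tree (dir-edge O u v d) (subst₂ _<_ (sym (lab≡pos v)) (sym (lab≡pos u)) (pos-up u v d))
    ... | false with towards tree u v in t
    ...   | false = refl
    ...   | true with towards-true tree t
    ...     | a , v<u with orient O u v a
    ...       | inj₁ (u→v , _) = true≢false (trans (sym u→v) d)
    ...       | inj₂ (_ , v→u) = contradiction (pos-up v u v→u) (ℕₚ.<⇒≯ (subst₂ _<_ (lab≡pos v) (lab≡pos u) v<u))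

  Φ-surjective : ∀ (O : AcyclicOrientation G) → ∃[ TG ] (∀ u v → dir (Φ TG) u v ≡ dir O u v)
  Φ-surjective O = (tree , good) , realises
    where open FromOrientation O

  linear-extension : ∀ (TG : GoodTree G) p → IsPT (proj₁ TG) p →
    ∃[ f ] ((∀ m → suc (toℕ (f m)) ≡ suc n ∸ toℕ (p (just m))) × IsLinearExtension (Φ TG) f)
  linear-extension (T , _) p isPT with LabelFacts.reversed T p isPT
  ... | f , shifted , bijective , reverses = f , shifted , bijective , λ u v u<v →
    reverses u v (subst₂ _<_ (lab-unique T p isPT v) (lab-unique T p isPT u) (path-decreases T u<v))

  first-step : ∀ T {i w} → TransClosure (λ a b → towards T a b ≡ true) i w →
               ∃ λ w₁ → towards T i w₁ ≡ true × lab T w ≤ lab T w₁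
  first-step T [ e ] = _ , e , ℕₚ.≤-refl
  first-step T (e ∷ rest) = _ , e , ℕₚ.<⇒≤ (path-decreases T rest)

  -- A tree edge i → k is a cover: a path i → w₁ → ⋯ → k of length ≥ 2 would
  -- start at an out-neighbour w₁ labelled above k = par i.
  tree-edges-cover : ∀ (TG : GoodTree G) i k → par (proj₁ TG) i ≡ just k → Covers (Φ TG) k i
  tree-edges-cover (T , good) i k e = [ parent-edge T i k e ] , no-middle
    where
      no-middle : ¬ ∃ λ w → i <[ Φ (T , good) ] w × w <[ Φ (T , good) ] k
      no-middle (w , i<w , w<k) with first-step T i<w
      ... | w₁ , i→w₁ , w≤w₁ = ℕₚ.<-irrefl refl (begin-strict
            lab T k   <⟨ path-decreases T w<k ⟩
            lab T w   ≤⟨ w≤w₁ ⟩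
            lab T w₁  ≤⟨ subst (λ v → lab T w₁ ≤ Facts.ℓ T v) e (out-neighbour≤parent (T , good) i w₁ i→w₁) ⟩
            lab T k   ∎)
        where open ℕₚ.≤-Reasoning

proposition4p15 : ∀ (n : ℕ) (G : SimpleGraph n) →
    (∀ (T : RootedTree G) → ∃[ p ] IsPT T p)
    × Σ (GoodTree G → AcyclicOrientation G) λ Φ →
        IsBijection Φ
        × (∀ (T : GoodTree G) p → IsPT (proj₁ T) p →
             (∃[ f ] ((∀ m → suc (toℕ (f m)) ≡ suc n ∸ toℕ (p (just m)))
                      × IsLinearExtension (Φ T) f))
             × (∀ i k → par (proj₁ T) i ≡ just k → Covers (Φ T) k i))
proposition4p15 n G =
  TreeLabelling.labelling ,
  Φ ,
  (Φ-injective , Φ-surjective) ,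
  λ T p isPT → linear-extension T p isPT , tree-edges-cover T
  where open Bijection G
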